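{- Let $n\ge 1$ and let $A=\{a_1,a_2\}$ (so $m=2$). For all weight vectors $\mathbf{w},\mathbf{w}'\in\mathbb{N}_0^n$, the following are equivalent: $(r^A,\mathbf{w})\sim_2(r^A,\mathbf{w}')$; $(r^B,\mathbf{w})\sim_2(r^B,\mathbf{w}')$; $(r^C,\mathbf{w})\sim_2(r^C,\mathbf{w}')$; $(r^P,\mathbf{w})\sim_2(r^P,\mathbf{w}')$. In other words, the partitions of $\mathbb{N}_0^n$ into equivalence classes $\mathcal{E}^{r}_{\bar{\mathbf{w}},2}$ coincide for $r\in\{r^A,r^B,r^C,r^P\}$.
   Context: Players $N=\{1,\dots,n\}$; alternatives $A=\{a_1,\dots,a_m\}$ with the fixed index order used for tie breaking; $\mathcal{P}(A)$ is the set of strict linear orders on $A$, and a profile is $\mathbf{P}=(P_1,\dots,P_n)\in\mathcal{P}(A)^n$. For a weight vector $\mathbf{w}\in\mathbb{N}_0^n$, $\mathbf{w}\neq\mathbf{0}$, and a profile $\mathbf{P}$, the weighted rules are: antiplurality $r^A|\mathbf{w}(\mathbf{P})$ is the alternative minimizing $\sum_{i:\,a\text{ is ranked last by }P_i} w_i$; Borda $r^B|\mathbf{w}(\mathbf{P})$ maximizes $\sum_i w_i\, b_i(a,\mathbf{P})$ where $b_i(a,\mathbf{P})=|\{a'\in A: a\,P_i\,a'\}|$; plurality $r^P|\mathbf{w}(\mathbf{P})$ maximizes $\sum_{i:\,a\text{ is ranked first by }P_i} w_i$; Copeland $r^C|\mathbf{w}(\mathbf{P})$ maximizes $|\{a'\in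 A: a\succ a'\}|$, where $a\succ a'$ iff $\sum_{i: aP_ia'}w_i>\sum_{i:a'P_ia}w_i$. In every case ties among optimal alternatives are broken lexicographically (the one with smallest index wins). (Equivalently, $r|\mathbf{w}$ applies the unweighted rule to the profile in which $P_i$ is repeated $w_i$ times.) For $\mathbf{w}=\mathbf{0}$ set $r|\mathbf{0}(\mathbf{P})=a_1$ for all $\mathbf{P}$. Structural equivalence: $(r,\mathbf{w})\sim_m(r,\mathbf{w}')$ means there exist bijections $\pi:N\to N$ and $\tilde\pi:A\to A$ such that for every $\mathbf{P}\in\mathcal{P}(A)^n$, letting $\mathbf{P}'$ be the profile with $\tilde\pi(a_j)\,P'_{\pi(i)}\,\tilde\pi(a_k)\iff a_j\,P_i\,a_k$, one has $\tilde\pi(r|\mathbf{w}(\mathbf{P}))=r|\mathbf{w}'(\mathbf{P}')$. The equivalence class of $\bar{\mathbf{w}}$ is $\mathcal{E}^r_{\bar{\mathbf{w}},m}=\{\mathbf{w}\in\mathbb{N}_0^n:(r,\mathbf{w})\sim_m(r,\bar{\mathbf{w}})\}$. -}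

module Defs where

open import Data.Nat using (ℕ; zero; suc; _+_; _<_; _<?_)
open import Data.Fin using (Fin; zero; suc; toℕ)
open import Data.Fin.Permutation using (Permutation′; _⟨$⟩ʳ_)
open import Data.Product using (Σ; _×_; _,_)
open import Relation.Binary.PropositionalEquality using (_≡_)
open import Relation.Nullary.Decidable using (Dec; yes; no; ⌊_⌋)
open import Data.Bool using (Bool; true; false; if_then_else_)
open import Function.Bundles using (_⇔_)

∑ : ∀ {n} → (Fin n → ℕ) → ℕ
∑ {zero}  f = 0
∑ {suc n} f = f zero + ∑ (λ i → f (suc i))

𝟙 : ∀ {p} {P : Set p} → Dec P → ℕ
𝟙 (yes _) = 1
𝟙 (no _)  = 0

-- A strict linear order on the alternatives Fin m, given by the
-- bijective ranking: σ ⟨$⟩ʳ a is the position of a (position 0 = top).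
LinOrd : ℕ → Set
LinOrd m = Permutation′ m

pos : ∀ {m} → LinOrd m → Fin m → ℕ
pos σ a = toℕ (σ ⟨$⟩ʳ a)

_≺[_]_ : ∀ {m} → Fin m → LinOrd m → Fin m → Set
a ≺[ σ ] b = pos σ a < pos σ b

Profile : ℕ → ℕ → Set
Profile m n = Fin n → LinOrd m

Weights : ℕ → Set
Weights n = Fin n → ℕ

-- First (smallest-index) maximiser / minimiser of a score over Fin (suc k).
argmax : ∀ {k} → (Fin (suc k) → ℕ) → Fin (suc k)
argmax {zero}  f = zero
argmax {suc k} f with argmax (λ i → f (suc i))
... | j = if ⌊ f zero <? f (suc j) ⌋ then suc j else zero

argmin : ∀ {k} → (Fin (suc k) → ℕ) → Fin (suc k)
argmin {zero}  f = zero
argmin {suc k} f with argmin (λ i → f (suc i))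
... | j = if ⌊ f (suc j) <? f zero ⌋ then suc j else zero

-- Weighted voting rule over alternatives Fin (suc k) (a_1 = zero).
Rule : ℕ → ℕ → Set
Rule k n = Weights n → Profile (suc k) n → Fin (suc k)

Top? : ∀ {k} (σ : LinOrd (suc k)) (a : Fin (suc k)) → Dec (pos σ a ≡ 0)
Top? σ a = Data.Nat._≟_ (pos σ a) 0

Last? : ∀ {k} (σ : LinOrd (suc k)) (a : Fin (suc k)) → Dec (pos σ a ≡ k)
Last? {k} σ a = Data.Nat._≟_ (pos σ a) k

borda : ∀ {m} → LinOrd m → Fin m → ℕ
borda σ a = ∑ (λ a' → 𝟙 (pos σ a <? pos σ a'))

antiplurality : ∀ {k n} → Rule k n
antiplurality w P = argmin (λ a → ∑ (λ i → w i Data.Nat.* 𝟙 (Last? (P i) a)))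

plurality : ∀ {k n} → Rule k n
plurality w P = argmax (λ a → ∑ (λ i → w i Data.Nat.* 𝟙 (Top? (P i) a)))

bordaRule : ∀ {k n} → Rule k n
bordaRule w P = argmax (λ a → ∑ (λ i → w i Data.Nat.* borda (P i) a))

support : ∀ {m n} → Weights n → Profile m n → Fin m → Fin m → ℕ
support w P a a' = ∑ (λ i → w i Data.Nat.* 𝟙 (pos (P i) a <? pos (P i) a'))

copeland : ∀ {k n} → Rule k n
copeland w P = argmax (λ a → ∑ (λ a' → 𝟙 (support w P a' a <? support w P a a')))

-- Structural equivalence (r, w) ∼_m (r, w'), with m = suc k.
-- (For w = 0 every rule above already returns a_1 = zero.)
StructEquiv : ∀ {k n} → Rule k n → Weights n → Weights n → Set
StructEquiv {k} {n} r w w' =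
  Σ (Permutation′ n) λ π → Σ (Permutation′ (suc k)) λ π̃ →
    ∀ (P P' : Profile (suc k) n) →
    (∀ i j l → (j ≺[ P i ] l) ⇔ ((π̃ ⟨$⟩ʳ j) ≺[ P' (π ⟨$⟩ʳ i) ] (π̃ ⟨$⟩ʳ l))) →
    π̃ ⟨$⟩ʳ r w P ≡ r w' P'

-- With only two alternatives a ballot is determined by its top choice: an
-- alternative is ranked last exactly when the other one is ranked first, its
-- Borda score is 1 or 0 according as it is ranked first or not, and it beats
-- the other alternative in a ballot exactly when it tops that ballot. Hence
-- antiplurality, Borda and Copeland all return the plurality winner on every
-- weighted profile, and structural equivalence only depends on the rule as a
-- function of (w, P).
module Submission where

open import Defs
open import Data.Nat using (ℕ; suc; _≥_; _<?_; _+_; _*_)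
open import Data.Nat.Properties using (n≮n; <-asym; +-identityʳ)
open import Data.Fin using (Fin; zero; suc; opposite)
open import Data.Fin.Permutation using (Permutation′; _⟨$⟩ʳ_; _⟨$⟩ˡ_; inverseˡ)
open import Data.Product using (_×_; _,_)
open import Function.Bundles using (_⇔_; mk⇔)
open import Function.Properties.Equivalence using () renaming (sym to ⇔-sym; trans to ⇔-trans)
open import Relation.Binary.PropositionalEquality
  using (_≡_; _≢_; refl; sym; trans; cong; cong₂; module ≡-Reasoning)
open import Relation.Nullary using (yes; no)
open import Data.Empty using (⊥-elim)

StructEquiv-cong : ∀ {k n} {r r′ : Rule k n} → (∀ w P → r w P ≡ r′ w P) →
                   ∀ w w′ → StructEquiv r w w′ ⇔ StructEquiv r′ w w′
StructEquiv-cong {k} {n} r≗r′ w w′ = mk⇔ (transport r≗r′) (transport (λ v P → sym (r≗r′ v P)))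
  where
  transport : ∀ {s s′ : Rule k n} → (∀ v P → s v P ≡ s′ v P) → StructEquiv s w w′ → StructEquiv s′ w w′
  transport s≗s′ (π , π̃ , commutes) = π , π̃ , λ P P′ P≅P′ →
    trans (cong (π̃ ⟨$⟩ʳ_) (sym (s≗s′ w P))) (trans (commutes P P′ P≅P′) (s≗s′ w′ P′))

∑-cong : ∀ {n} {f g : Fin n → ℕ} → (∀ i → f i ≡ g i) → ∑ f ≡ ∑ g
∑-cong {0}     f≗g = refl
∑-cong {suc n} f≗g = cong₂ _+_ (f≗g zero) (∑-cong (λ i → f≗g (suc i)))

𝟙-n<n : ∀ x → 𝟙 (x <? x) ≡ 0
𝟙-n<n x with x <? x
... | yes x<x = ⊥-elim (n≮n x x<x)
... | no _    = refl

score : ∀ {m n} → (LinOrd m → Fin m → ℕ) → Weights n → Profile m n → Fin m → ℕ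
score s w P a = ∑ (λ i → w i * s (P i) a)

score-cong : ∀ {m n} {s t : LinOrd m → Fin m → ℕ} → (∀ σ a → s σ a ≡ t σ a) →
             ∀ w (P : Profile m n) a → score s w P a ≡ score t w P a
score-cong s≗t w P a = ∑-cong (λ i → cong (w i *_) (s≗t (P i) a))

top : ∀ {k} → LinOrd (suc k) → Fin (suc k) → ℕ
top σ a = 𝟙 (Top? σ a)

argmax-cong : ∀ {k} {f g : Fin (suc k) → ℕ} → (∀ a → f a ≡ g a) → argmax f ≡ argmax g
argmax-cong {0}     f≗g = refl
argmax-cong {suc k} {f} {g} f≗g
  rewrite argmax-cong {f = λ a → f (suc a)} {g = λ a → g (suc a)} (λ a → f≗g (suc a))
        | f≗g zero | f≗g (suc (argmax (λ a → g (suc a)))) = refl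

argmin-cong : ∀ {k} {f g : Fin (suc k) → ℕ} → (∀ a → f a ≡ g a) → argmin f ≡ argmin g
argmin-cong {0}     f≗g = refl
argmin-cong {suc k} {f} {g} f≗g
  rewrite argmin-cong {f = λ a → f (suc a)} {g = λ a → g (suc a)} (λ a → f≗g (suc a))
        | f≗g zero | f≗g (suc (argmin (λ a → g (suc a)))) = refl

argmin∘opposite≡argmax : (f : Fin 2 → ℕ) → argmin (λ a → f (opposite a)) ≡ argmax f
argmin∘opposite≡argmax f = refl

≢⇒≡opposite : {a b : Fin 2} → a ≢ b → a ≡ opposite b
≢⇒≡opposite {zero}     {zero}     a≢b = ⊥-elim (a≢b refl)
≢⇒≡opposite {zero}     {suc zero} _   = refl
≢⇒≡opposite {suc zero} {zero}     _   = refl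
≢⇒≡opposite {suc zero} {suc zero} a≢b = ⊥-elim (a≢b refl)

opposite-≢ : (a : Fin 2) → opposite a ≢ a
opposite-≢ zero       ()
opposite-≢ (suc zero) ()

⟨$⟩ʳ-injective : ∀ {m} (σ : Permutation′ m) {a b} → σ ⟨$⟩ʳ a ≡ σ ⟨$⟩ʳ b → a ≡ b
⟨$⟩ʳ-injective σ {a} {b} σa≡σb = begin
  a                     ≡⟨ sym (inverseˡ σ) ⟩
  σ ⟨$⟩ˡ (σ ⟨$⟩ʳ a)      ≡⟨ cong (σ ⟨$⟩ˡ_) σa≡σb ⟩
  σ ⟨$⟩ˡ (σ ⟨$⟩ʳ b)      ≡⟨ inverseˡ σ ⟩
  b                     ∎
  where open ≡-Reasoning

⟨$⟩ʳ-opposite : (σ : LinOrd 2) (a : Fin 2) → σ ⟨$⟩ʳ opposite a ≡ opposite (σ ⟨$⟩ʳ a)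
⟨$⟩ʳ-opposite σ a = ≢⇒≡opposite (λ σā≡σa → opposite-≢ a (⟨$⟩ʳ-injective σ σā≡σa))

last≡top∘opposite : (σ : LinOrd 2) (a : Fin 2) → 𝟙 (Last? σ a) ≡ top σ (opposite a)
last≡top∘opposite σ a rewrite ⟨$⟩ʳ-opposite σ a with σ ⟨$⟩ʳ a
... | zero     = refl
... | suc zero = refl

beats-opposite≡top : (σ : LinOrd 2) (a : Fin 2) → 𝟙 (pos σ a <? pos σ (opposite a)) ≡ top σ a
beats-opposite≡top σ a rewrite ⟨$⟩ʳ-opposite σ a with σ ⟨$⟩ʳ a
... | zero     = refl
... | suc zero = refl

borda≡beats-opposite : (σ : LinOrd 2) (a : Fin 2) → borda σ a ≡ 𝟙 (pos σ a <? pos σ (opposite a))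
borda≡beats-opposite σ zero       rewrite 𝟙-n<n (pos σ zero) = +-identityʳ _
borda≡beats-opposite σ (suc zero) rewrite 𝟙-n<n (pos σ (suc zero)) = +-identityʳ _

borda≡top : (σ : LinOrd 2) (a : Fin 2) → borda σ a ≡ top σ a
borda≡top σ a = trans (borda≡beats-opposite σ a) (beats-opposite≡top σ a)

copelandWinner≡majorityWinner : (s : Fin 2 → Fin 2 → ℕ) →
  argmax (λ a → ∑ (λ b → 𝟙 (s b a <? s a b))) ≡ argmax (λ a → s a (opposite a))
copelandWinner≡majorityWinner s
  rewrite 𝟙-n<n (s zero zero) | 𝟙-n<n (s (suc zero) (suc zero))
  with s zero (suc zero) <? s (suc zero) zero | s (suc zero) zero <? s zero (suc zero)
... | yes p | yes q = ⊥-elim (<-asym p q)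
... | yes _ | no  _ = refl
... | no  _ | yes _ = refl
... | no  _ | no  _ = refl

module _ {n : ℕ} (w : Weights n) (P : Profile 2 n) where
  open ≡-Reasoning

  antiplurality≡plurality : antiplurality w P ≡ plurality w P
  antiplurality≡plurality = begin
    argmin (score (λ σ a → 𝟙 (Last? σ a)) w P)    ≡⟨ argmin-cong (score-cong last≡top∘opposite w P) ⟩
    argmin (λ a → score top w P (opposite a))      ≡⟨ argmin∘opposite≡argmax (score top w P) ⟩
    argmax (score top w P)                         ∎

  bordaRule≡plurality : bordaRule w P ≡ plurality w P
  bordaRule≡plurality = argmax-cong (score-cong borda≡top w P)

  copeland≡plurality : copeland w P ≡ plurality w P
  copeland≡plurality = begin
    copeland w P                                   ≡⟨ copelandWinner≡majorityWinner (support w P) ⟩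
    argmax (λ a → support w P a (opposite a))      ≡⟨ argmax-cong (score-cong beats-opposite≡top w P) ⟩
    argmax (score top w P)                         ∎

proposition1 : ∀ (n : ℕ) → n ≥ 1 → ∀ (w w' : Weights n) →
    (StructEquiv {1} antiplurality w w' ⇔ StructEquiv {1} bordaRule w w')
    × (StructEquiv {1} bordaRule w w' ⇔ StructEquiv {1} copeland w w')
    × (StructEquiv {1} copeland w w' ⇔ StructEquiv {1} plurality w w')
proposition1 n _ w w′ =
    ⇔-trans anti⇔plu (⇔-sym borda⇔plu)
  , ⇔-trans borda⇔plu (⇔-sym copeland⇔plu)
  , copeland⇔plu
  where
  anti⇔plu : StructEquiv antiplurality w w′ ⇔ StructEquiv plurality w w′
  anti⇔plu = StructEquiv-cong antiplurality≡plurality w w′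
  borda⇔plu : StructEquiv bordaRule w w′ ⇔ StructEquiv plurality w w′
  borda⇔plu = StructEquiv-cong bordaRule≡plurality w w′
  copeland⇔plu : StructEquiv copeland w w′ ⇔ StructEquiv plurality w w′
  copeland⇔plu = StructEquiv-cong copeland≡plurality w w′
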